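{- Let $RM_3(n)$ be the maximum, over all $3$-colorings of $[1,n]$, of the number of rainbow triples $(x,y,z)$ with $x,y,z\in[1,n]$, $x\leq y$ and $x+y<z$. Then $$\frac{n^3}{31}(1+o(1))<RM_3(n)\leq \frac{n^3}{27}(1+o(1)).$$
   Context: $[1,n]=\{1,\dots,n\}$. A $3$-coloring of $[1,n]$ is a function $[1,n]\to\{1,2,3\}$; a triple is rainbow if its entries receive three pairwise distinct colors. $o(1)$ denotes terms tending to $0$ as $n\to\infty$. -}

module Defs where

open import Data.Nat using (ℕ; zero; suc; _+_; _≤ᵇ_; _<ᵇ_; _⊔_)
open import Data.Fin using (Fin; toℕ; _≟_)
open import Data.Bool using (Bool; _∧_; not)
open import Data.List using (List; []; _∷_; map; concatMap; filterᵇ; length; foldr; allFin)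
open import Data.Product using (_×_; _,_)
open import Data.Vec.Functional using (Vector) renaming (_∷_ to _∷ᶠ_)
open import Relation.Nullary.Decidable using (⌊_⌋)

-- A 3-coloring of [1,n]: the integer i ∈ [1,n] is represented by the
-- element i-1 of Fin n; colors are Fin 3.
Coloring : ℕ → Set
Coloring n = Fin n → Fin 3

val : {n : ℕ} → Fin n → ℕ
val x = suc (toℕ x)

allColorings : (n : ℕ) → List (Coloring n)
allColorings zero = (λ ()) ∷ []
allColorings (suc n) =
  concatMap (λ f → map (λ a → a ∷ᶠ f) (allFin 3)) (allColorings n)

allTriples : (n : ℕ) → List (Fin n × Fin n × Fin n)
allTriples n =
  concatMap (λ x → concatMap (λ y → map (λ z → (x , y , z)) (allFin n)) (allFin n)) (allFin n)

distinct : Fin 3 → Fin 3 → Bool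
distinct a b = not ⌊ a ≟ b ⌋

counted : {n : ℕ} → Coloring n → Fin n × Fin n × Fin n → Bool
counted c (x , y , z) =
  (val x ≤ᵇ val y) ∧ ((val x + val y) <ᵇ val z)
  ∧ distinct (c x) (c y) ∧ distinct (c y) (c z) ∧ distinct (c x) (c z)

rainbowCount : {n : ℕ} → Coloring n → ℕ
rainbowCount {n} c = length (filterᵇ (counted c) (allTriples n))

RM3 : ℕ → ℕ
RM3 n = foldr _⊔_ 0 (map rainbowCount (allColorings n))

-- Upper bound: a triple x < y < z is rainbow only if it meets each of the three color
-- classes A, B, C once, so there are at most |A| |B| |C| ≤ ((|A| + |B| + |C|) / 3)³ = n³/27
-- counted triples (x ≤ y and rainbow force x < y, and x + y < z forces y < z).
-- Lower bound: color [1,90] by the three intervals [1,24], [25,57], [58,90]; this coloring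
-- has 23536 ≥ 90³/31 counted triples, and replacing every element by a block of p consecutive
-- integers of the same color multiplies that number by at least p³.

module Submission where

module FiniteSums where

  open import Data.Nat
  open import Data.Nat.Properties
  open import Data.Bool using (Bool; true; false; T)
  open import Data.List using (List; []; _∷_; _++_; map; concatMap; filterᵇ; length; tabulate; allFin)
  open import Data.List.Properties using (map-tabulate)
  open import Data.Fin using (toℕ) renaming (suc to fsuc)
  open import Function using (_∘_; id)
  open import Relation.Nullary using (¬_; contradiction)
  open import Relation.Binary.PropositionalEquality

  𝟙 : Bool → ℕ
  𝟙 true = 1
  𝟙 false = 0

  𝟙-≤ : ∀ {b m} → (T b → 1 ≤ m) → 𝟙 b ≤ m
  𝟙-≤ {true} h = h _
  𝟙-≤ {false} h = z≤n

  T⇒1≤𝟙 : ∀ {b} → T b → 1 ≤ 𝟙 b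
  T⇒1≤𝟙 {true} _ = ≤-refl

  T⇒𝟙≡1 : ∀ {b} → T b → 𝟙 b ≡ 1
  T⇒𝟙≡1 {true} _ = refl

  ¬T⇒𝟙≡0 : ∀ {b} → ¬ T b → 𝟙 b ≡ 0
  ¬T⇒𝟙≡0 {true} ¬t = contradiction _ ¬t
  ¬T⇒𝟙≡0 {false} _ = refl

  1≤𝟙⇒T : ∀ {b} → 1 ≤ 𝟙 b → T b
  1≤𝟙⇒T {true} _ = _

  𝟙-mono : ∀ {b b′} → (T b → T b′) → 𝟙 b ≤ 𝟙 b′
  𝟙-mono h = 𝟙-≤ (T⇒1≤𝟙 ∘ h)

  private variable A B : Set

  ∑ : List A → (A → ℕ) → ℕ
  ∑ [] f = 0
  ∑ (a ∷ l) f = f a + ∑ l f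

  ∑-cong : ∀ (l : List A) {f g : A → ℕ} → (∀ a → f a ≡ g a) → ∑ l f ≡ ∑ l g
  ∑-cong [] e = refl
  ∑-cong (a ∷ l) e = cong₂ _+_ (e a) (∑-cong l e)

  ∑-mono : ∀ (l : List A) {f g : A → ℕ} → (∀ a → f a ≤ g a) → ∑ l f ≤ ∑ l g
  ∑-mono [] h = z≤n
  ∑-mono (a ∷ l) h = +-mono-≤ (h a) (∑-mono l h)

  ∑-++ : ∀ (l₁ l₂ : List A) f → ∑ (l₁ ++ l₂) f ≡ ∑ l₁ f + ∑ l₂ f
  ∑-++ [] l₂ f = refl
  ∑-++ (a ∷ l₁) l₂ f = trans (cong (f a +_) (∑-++ l₁ l₂ f)) (sym (+-assoc (f a) _ _))

  ∑-map : ∀ (g : A → B) (l : List A) f → ∑ (map g l) f ≡ ∑ l (f ∘ g)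
  ∑-map g [] f = refl
  ∑-map g (a ∷ l) f = cong (f (g a) +_) (∑-map g l f)

  ∑-concatMap : ∀ (g : A → List B) (l : List A) f →
    ∑ (concatMap g l) f ≡ ∑ l (λ a → ∑ (g a) f)
  ∑-concatMap g [] f = refl
  ∑-concatMap g (a ∷ l) f = trans (∑-++ (g a) (concatMap g l) f) (cong (∑ (g a) f +_) (∑-concatMap g l f))

  length-filterᵇ : ∀ (p : A → Bool) l → length (filterᵇ p l) ≡ ∑ l (𝟙 ∘ p)
  length-filterᵇ p [] = refl
  length-filterᵇ p (a ∷ l) with p a
  ... | true = cong suc (length-filterᵇ p l)
  ... | false = length-filterᵇ p l

  ∑-1≡length : ∀ (l : List A) → ∑ l (λ _ → 1) ≡ length l
  ∑-1≡length [] = refl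
  ∑-1≡length (a ∷ l) = cong suc (∑-1≡length l)

  ∑-+ : ∀ (l : List A) f g → ∑ l (λ a → f a + g a) ≡ ∑ l f + ∑ l g
  ∑-+ [] f g = refl
  ∑-+ (a ∷ l) f g = begin
    f a + g a + ∑ l (λ a → f a + g a) ≡⟨ cong (f a + g a +_) (∑-+ l f g) ⟩
    f a + g a + (∑ l f + ∑ l g)       ≡⟨ +-assoc (f a) (g a) _ ⟩
    f a + (g a + (∑ l f + ∑ l g))     ≡⟨ cong (f a +_) (x∙yz≈y∙xz (g a) (∑ l f) (∑ l g)) ⟩
    f a + (∑ l f + (g a + ∑ l g))     ≡⟨ +-assoc (f a) _ _ ⟨
    f a + ∑ l f + (g a + ∑ l g)       ∎
    where
    open ≡-Reasoning
    open import Algebra.Properties.CommutativeSemigroup +-commutativeSemigroup using (x∙yz≈y∙xz)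

  ∑-*ˡ : ∀ (l : List A) k f → ∑ l (λ a → k * f a) ≡ k * ∑ l f
  ∑-*ˡ [] k f = sym (*-zeroʳ k)
  ∑-*ˡ (a ∷ l) k f = trans (cong (k * f a +_) (∑-*ˡ l k f)) (sym (*-distribˡ-+ k (f a) _))

  ∑-*ʳ : ∀ (l : List A) k f → ∑ l (λ a → f a * k) ≡ ∑ l f * k
  ∑-*ʳ l k f = trans (∑-cong l (λ a → *-comm (f a) k)) (trans (∑-*ˡ l k f) (*-comm k _))

  ∑-swap : ∀ (l₁ : List A) (l₂ : List B) (f : A → B → ℕ) →
    ∑ l₁ (λ a → ∑ l₂ (f a)) ≡ ∑ l₂ (λ b → ∑ l₁ (λ a → f a b))
  ∑-swap [] l₂ f = sym (∑-0 l₂)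
    where
    ∑-0 : (l : List B) → ∑ l (λ _ → 0) ≡ 0
    ∑-0 [] = refl
    ∑-0 (b ∷ l) = ∑-0 l
  ∑-swap (a ∷ l₁) l₂ f =
    trans (cong (∑ l₂ (f a) +_) (∑-swap l₁ l₂ f)) (sym (∑-+ l₂ (f a) (λ b → ∑ l₁ (λ a′ → f a′ b))))

  ∑< : ℕ → (ℕ → ℕ) → ℕ
  ∑< zero f = 0
  ∑< (suc n) f = f 0 + ∑< n (f ∘ suc)

  ∑-allFin : ∀ n (f : ℕ → ℕ) → ∑ (allFin n) (f ∘ toℕ) ≡ ∑< n f
  ∑-allFin zero f = refl
  ∑-allFin (suc n) f = cong (f 0 +_) (begin
    ∑ (tabulate {n = n} fsuc) (f ∘ toℕ) ≡⟨ cong (λ l → ∑ l (f ∘ toℕ)) (map-tabulate {n = n} id fsuc) ⟨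
    ∑ (map fsuc (allFin n)) (f ∘ toℕ)  ≡⟨ ∑-map fsuc (allFin n) (f ∘ toℕ) ⟩
    ∑ (allFin n) (f ∘ suc ∘ toℕ)       ≡⟨ ∑-allFin n (f ∘ suc) ⟩
    ∑< n (f ∘ suc)                     ∎)
    where open ≡-Reasoning

  ∑<-cong : ∀ n {f g : ℕ → ℕ} → (∀ i → f i ≡ g i) → ∑< n f ≡ ∑< n g
  ∑<-cong zero e = refl
  ∑<-cong (suc n) e = cong₂ _+_ (e 0) (∑<-cong n (e ∘ suc))

  ∑<-mono : ∀ n {f g : ℕ → ℕ} → (∀ i → i < n → f i ≤ g i) → ∑< n f ≤ ∑< n g
  ∑<-mono zero h = z≤n
  ∑<-mono (suc n) h = +-mono-≤ (h 0 z<s) (∑<-mono n (λ i i<n → h (suc i) (s<s i<n)))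

  ∑<-+ : ∀ m n f → ∑< (m + n) f ≡ ∑< m f + ∑< n (λ j → f (m + j))
  ∑<-+ zero n f = refl
  ∑<-+ (suc m) n f = trans (cong (f 0 +_) (∑<-+ m n (f ∘ suc))) (sym (+-assoc (f 0) _ _))

  ∑<-monoˡ : ∀ {m n} f → m ≤ n → ∑< m f ≤ ∑< n f
  ∑<-monoˡ {m} {n} f m≤n = begin
    ∑< m f                                  ≤⟨ m≤m+n _ _ ⟩
    ∑< m f + ∑< (n ∸ m) (λ j → f (m + j))   ≡⟨ ∑<-+ m (n ∸ m) f ⟨
    ∑< (m + (n ∸ m)) f                      ≡⟨ cong (λ k → ∑< k f) (m+[n∸m]≡n m≤n) ⟩
    ∑< n f                                  ∎
    where open ≤-Reasoning

  ∑<-const : ∀ n k → ∑< n (λ _ → k) ≡ n * k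
  ∑<-const zero k = refl
  ∑<-const (suc n) k = cong (k +_) (∑<-const n k)

  ∑<-*ˡ : ∀ n k f → ∑< n (λ i → k * f i) ≡ k * ∑< n f
  ∑<-*ˡ zero k f = sym (*-zeroʳ k)
  ∑<-*ˡ (suc n) k f = trans (cong (k * f 0 +_) (∑<-*ˡ n k (f ∘ suc))) (sym (*-distribˡ-+ k (f 0) _))

  ∑<-blocks : ∀ t p f → ∑< (t * p) f ≡ ∑< t (λ X → ∑< p (λ j → f (X * p + j)))
  ∑<-blocks zero p f = refl
  ∑<-blocks (suc t) p f = begin
    ∑< (p + t * p) f                                           ≡⟨ ∑<-+ p (t * p) f ⟩
    ∑< p f + ∑< (t * p) (λ i → f (p + i))                      ≡⟨ cong (∑< p f +_) (∑<-blocks t p _) ⟩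
    ∑< p f + ∑< t (λ X → ∑< p (λ j → f (p + (X * p + j))))     ≡⟨ cong (∑< p f +_) (∑<-cong t λ X →
                                                                    ∑<-cong p λ j → cong f (sym (+-assoc p (X * p) j))) ⟩
    ∑< p f + ∑< t (λ X → ∑< p (λ j → f (suc X * p + j)))       ∎
    where open ≡-Reasoning

  ∑<-blowUp : ∀ t p {g f : ℕ → ℕ} → (∀ X j → j < p → g X ≤ f (X * p + j)) → p * ∑< t g ≤ ∑< (t * p) f
  ∑<-blowUp t p {g} {f} g≤f = begin
    p * ∑< t g                                   ≡⟨ ∑<-*ˡ t p g ⟨
    ∑< t (λ X → p * g X)                         ≡⟨ ∑<-cong t (λ X → ∑<-const p (g X)) ⟨
    ∑< t (λ X → ∑< p (λ _ → g X))                ≤⟨ ∑<-mono t (λ X _ → ∑<-mono p (λ j j<p → g≤f X j j<p)) ⟩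
    ∑< t (λ X → ∑< p (λ j → f (X * p + j)))      ≡⟨ ∑<-blocks t p f ⟨
    ∑< (t * p) f                                 ∎
    where open ≤-Reasoning

module TripleSums where

  open import Data.Nat
  open import Data.Nat.Tactic.RingSolver
  open import Data.List using (List)
  open import Relation.Binary.PropositionalEquality
  open FiniteSums

  permSum : {A : Set} → (A → A → A → ℕ) → A → A → A → ℕ
  permSum f x y z = f x y z + f x z y + f y x z + f y z x + f z x y + f z y x

  module _ {A : Set} (L : List A) where

    ∑³ : (A → A → A → ℕ) → ℕ
    ∑³ f = ∑ L λ x → ∑ L λ y → ∑ L λ z → f x y z

    ∑³-cong : ∀ {f g : A → A → A → ℕ} → (∀ x y z → f x y z ≡ g x y z) → ∑³ f ≡ ∑³ g
    ∑³-cong e = ∑-cong L λ x → ∑-cong L λ y → ∑-cong L λ z → e x y z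

    ∑³-mono : ∀ {f g : A → A → A → ℕ} → (∀ x y z → f x y z ≤ g x y z) → ∑³ f ≤ ∑³ g
    ∑³-mono h = ∑-mono L λ x → ∑-mono L λ y → ∑-mono L λ z → h x y z

    ∑³-+ : ∀ f g → ∑³ (λ x y z → f x y z + g x y z) ≡ ∑³ f + ∑³ g
    ∑³-+ f g = trans (∑-cong L λ x → trans (∑-cong L λ y → ∑-+ L (f x y) (g x y)) (∑-+ L _ _)) (∑-+ L _ _)

    ∑³-+₆ : ∀ f₁ f₂ f₃ f₄ f₅ f₆ →
      ∑³ (λ x y z → f₁ x y z + f₂ x y z + f₃ x y z + f₄ x y z + f₅ x y z + f₆ x y z)
        ≡ ∑³ f₁ + ∑³ f₂ + ∑³ f₃ + ∑³ f₄ + ∑³ f₅ + ∑³ f₆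
    ∑³-+₆ f₁ f₂ f₃ f₄ f₅ f₆ =
      trans (∑³-+ _ f₆) (cong (_+ ∑³ f₆)
      (trans (∑³-+ _ f₅) (cong (_+ ∑³ f₅)
      (trans (∑³-+ _ f₄) (cong (_+ ∑³ f₄)
      (trans (∑³-+ _ f₃) (cong (_+ ∑³ f₃)
      (∑³-+ f₁ f₂))))))))

    ∑³-swap₁₂ : ∀ h → ∑³ (λ x y z → h y x z) ≡ ∑³ h
    ∑³-swap₁₂ h = ∑-swap L L (λ x y → ∑ L (h y x))

    ∑³-swap₂₃ : ∀ h → ∑³ (λ x y z → h x z y) ≡ ∑³ h
    ∑³-swap₂₃ h = ∑-cong L λ x → ∑-swap L L (λ y z → h x z y)

    ∑³-rotate : ∀ h → ∑³ (λ x y z → h y z x) ≡ ∑³ h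
    ∑³-rotate h = trans (∑³-swap₁₂ (λ x y z → h x z y)) (∑³-swap₂₃ h)

    ∑³-product : ∀ f g h → ∑³ (λ x y z → f x * (g y * h z)) ≡ ∑ L f * (∑ L g * ∑ L h)
    ∑³-product f g h = begin
      ∑³ (λ x y z → f x * (g y * h z))
        ≡⟨ ∑-cong L (λ x → ∑-cong L λ y →
             trans (∑-*ˡ L (f x) (λ z → g y * h z)) (cong (f x *_) (∑-*ˡ L (g y) h))) ⟩
      ∑ L (λ x → ∑ L λ y → f x * (g y * ∑ L h))
        ≡⟨ ∑-cong L (λ x → trans (∑-*ˡ L (f x) (λ y → g y * ∑ L h)) (cong (f x *_) (∑-*ʳ L (∑ L h) g))) ⟩
      ∑ L (λ x → f x * (∑ L g * ∑ L h))
        ≡⟨ ∑-*ʳ L _ f ⟩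
      ∑ L f * (∑ L g * ∑ L h) ∎
      where open ≡-Reasoning

    -- Each term g · (f ∘ σ) is reindexed by σ⁻¹; only the two 3-cycles trade places.
    ∑³-permSum-adjoint : ∀ g f →
      ∑³ (λ x y z → g x y z * permSum f x y z) ≡ ∑³ (λ x y z → permSum g x y z * f x y z)
    ∑³-permSum-adjoint g f = begin
      ∑³ (λ x y z → g x y z * permSum f x y z)
        ≡⟨ ∑³-cong (λ x y z → distribute (g x y z) _ _ _ _ _ _) ⟩
      ∑³ (λ x y z → g x y z * f x y z + g x y z * f x z y + g x y z * f y x z
                  + g x y z * f y z x + g x y z * f z x y + g x y z * f z y x)
        ≡⟨ ∑³-+₆ _ _ _ _ _ _ ⟩
      ∑³ (λ x y z → g x y z * f x y z) + ∑³ (λ x y z → g x y z * f x z y)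
        + ∑³ (λ x y z → g x y z * f y x z) + ∑³ (λ x y z → g x y z * f y z x)
        + ∑³ (λ x y z → g x y z * f z x y) + ∑³ (λ x y z → g x y z * f z y x)
        ≡⟨ cong₂ _+_ (cong₂ _+_ (cong₂ _+_ (cong₂ _+_ (cong₂ _+_ refl
             (∑³-swap₂₃ (λ x y z → g x z y * f x y z)))
             (∑³-swap₁₂ (λ x y z → g y x z * f x y z)))
             (∑³-rotate (λ x y z → g z x y * f x y z)))
             (sym (∑³-rotate (λ x y z → g x y z * f z x y))))
             (trans (∑³-swap₂₃ (λ x y z → g x z y * f y z x)) (∑³-rotate (λ x y z → g z y x * f x y z))) ⟩
      ∑³ (λ x y z → g x y z * f x y z) + ∑³ (λ x y z → g x z y * f x y z)
        + ∑³ (λ x y z → g y x z * f x y z) + ∑³ (λ x y z → g z x y * f x y z)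
        + ∑³ (λ x y z → g y z x * f x y z) + ∑³ (λ x y z → g z y x * f x y z)
        ≡⟨ ∑³-+₆ _ _ _ _ _ _ ⟨
      ∑³ (λ x y z → g x y z * f x y z + g x z y * f x y z + g y x z * f x y z
                  + g z x y * f x y z + g y z x * f x y z + g z y x * f x y z)
        ≡⟨ ∑³-cong (λ x y z → regroup (f x y z) (g x y z) (g x z y) (g y x z) (g y z x) (g z x y) (g z y x)) ⟩
      ∑³ (λ x y z → permSum g x y z * f x y z) ∎
      where
      open ≡-Reasoning
      distribute : ∀ m t₁ t₂ t₃ t₄ t₅ t₆ →
        m * (t₁ + t₂ + t₃ + t₄ + t₅ + t₆) ≡ m * t₁ + m * t₂ + m * t₃ + m * t₄ + m * t₅ + m * t₆
      distribute = solve-∀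
      regroup : ∀ m t₁ t₂ t₃ t₄ t₅ t₆ →
        t₁ * m + t₂ * m + t₃ * m + t₅ * m + t₄ * m + t₆ * m ≡ (t₁ + t₂ + t₃ + t₄ + t₅ + t₆) * m
      regroup = solve-∀

module RainbowTriples where

  open import Defs
  open import Data.Nat hiding (_≟_)
  open import Data.Nat.Properties hiding (_≟_)
  open import Data.Bool using (Bool; T; _∧_)
  open import Data.Bool.Properties using (T-∧)
  open import Data.Fin using (Fin; zero; suc; #_; _≟_)
  open import Data.Fin.Properties using (all?)
  open import Data.Product using (_×_; _,_)
  open import Function using (_∘_; Equivalence)
  open import Relation.Nullary.Decidable using (⌊_⌋; toWitness; toWitnessFalse)
  open import Relation.Binary.PropositionalEquality
  open FiniteSums
  open TripleSums using (permSum)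

  rainbow : Fin 3 → Fin 3 → Fin 3 → Bool
  rainbow α β γ = distinct α β ∧ distinct β γ ∧ distinct α γ

  -- Positions are 0-based (a stands for the integer a + 1), so that
  -- counted c (x , y , z) unfolds to countedTriple (toℕ x) (toℕ y) (toℕ z) (c x) (c y) (c z).
  countedTriple : ℕ → ℕ → ℕ → Fin 3 → Fin 3 → Fin 3 → Bool
  countedTriple a b d α β γ = (suc a ≤ᵇ suc b) ∧ ((suc a + suc b) <ᵇ suc d) ∧ rainbow α β γ

  distinct⇒≢ : ∀ {α β} → T (distinct α β) → α ≢ β
  distinct⇒≢ = toWitnessFalse

  rainbow⇒≢ : ∀ {α β γ} → T (rainbow α β γ) → α ≢ β × β ≢ γ × α ≢ γ
  rainbow⇒≢ r =
    let (α≠β , r′) = Equivalence.to T-∧ r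
        (β≠γ , α≠γ) = Equivalence.to T-∧ r′
    in  distinct⇒≢ α≠β , distinct⇒≢ β≠γ , distinct⇒≢ α≠γ

  countedTriple-elim : ∀ {a b d α β γ} → (a ≡ b → α ≡ β) → T (countedTriple a b d α β γ) →
    a < b × suc a + suc b ≤ d × T (rainbow α β γ)
  countedTriple-elim {a} {b} {d} sameColor t =
    let (a≤b , t′) = Equivalence.to T-∧ t
        (sum<d , r) = Equivalence.to T-∧ t′
        (α≢β , _) = rainbow⇒≢ r
    in  ≤∧≢⇒< (s≤s⁻¹ (≤ᵇ⇒≤ (suc a) (suc b) a≤b)) (α≢β ∘ sameColor)
      , s≤s⁻¹ (<ᵇ⇒< (suc a + suc b) (suc d) sum<d)
      , r

  countedTriple-intro : ∀ {a b d α β γ} → a ≤ b → suc a + suc b ≤ d → T (rainbow α β γ) →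
    T (countedTriple a b d α β γ)
  countedTriple-intro a≤b sum≤d r =
    Equivalence.from T-∧ (≤⇒≤ᵇ (s≤s a≤b) , Equivalence.from T-∧ (<⇒<ᵇ (s≤s sum≤d) , r))

  isColor : Fin 3 → Fin 3 → ℕ
  isColor k α = 𝟙 ⌊ α ≟ k ⌋

  isColor-partition : ∀ α → isColor (# 0) α + isColor (# 1) α + isColor (# 2) α ≡ 1
  isColor-partition zero = refl
  isColor-partition (suc zero) = refl
  isColor-partition (suc (suc zero)) = refl

  colored012 : Fin 3 → Fin 3 → Fin 3 → ℕ
  colored012 α β γ = isColor (# 0) α * (isColor (# 1) β * isColor (# 2) γ)

  rainbow≤permSum-colored012 : ∀ α β γ → 𝟙 (rainbow α β γ) ≤ permSum colored012 α β γ
  rainbow≤permSum-colored012 =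
    toWitness {a? = all? λ α → all? λ β → all? λ γ → 𝟙 (rainbow α β γ) ≤? permSum colored012 α β γ} _

  colored012≤rainbow : ∀ α β γ → colored012 α β γ ≤ 𝟙 (rainbow α β γ)
  colored012≤rainbow =
    toWitness {a? = all? λ α → all? λ β → all? λ γ → colored012 α β γ ≤? 𝟙 (rainbow α β γ)} _

module MaximalCount where

  open import Defs
  open import Data.Nat
  open import Data.Nat.Properties
  open import Data.List using ([]; _∷_; map; foldr; allFin)
  open import Data.List.Relation.Unary.Any using (Any; here; there)
  open import Data.List.Relation.Unary.Any.Properties using (concatMap⁺; map⁺)
  open import Data.Fin using () renaming (zero to fzero; suc to fsuc)
  open import Data.Product using (_,_)
  open import Data.Vec.Functional using () renaming (_∷_ to _∷ᶠ_)
  open import Function using (_∘_)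
  open import Relation.Binary.PropositionalEquality
  open FiniteSums
  open TripleSums

  rainbowCount≡∑³ : ∀ {n} (c : Coloring n) →
    rainbowCount c ≡ ∑³ (allFin n) (λ x y z → 𝟙 (counted c (x , y , z)))
  rainbowCount≡∑³ {n} c =
    trans (length-filterᵇ (counted c) (allTriples n))
    (trans (∑-concatMap _ (allFin n) (𝟙 ∘ counted c))
    (∑-cong (allFin n) λ x → trans (∑-concatMap _ (allFin n) _) (∑-cong (allFin n) λ y → ∑-map _ (allFin n) _)))

  rainbowCount-cong : ∀ {n} {c c′ : Coloring n} → (∀ i → c i ≡ c′ i) → rainbowCount c ≡ rainbowCount c′
  rainbowCount-cong {n} {c} {c′} e =
    trans (rainbowCount≡∑³ c) (trans (∑³-cong (allFin n) counted≡) (sym (rainbowCount≡∑³ c′)))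
    where
    counted≡ : ∀ x y z → 𝟙 (counted c (x , y , z)) ≡ 𝟙 (counted c′ (x , y , z))
    counted≡ x y z rewrite e x | e y | e z = refl

  allColorings-complete : ∀ n (c : Coloring n) → Any (λ c′ → ∀ i → c′ i ≡ c i) (allColorings n)
  allColorings-complete zero c = here (λ ())
  allColorings-complete (suc n) c = concatMap⁺ _ (extend (allColorings-complete n (c ∘ fsuc)))
    where
    extend : ∀ {l} → Any (λ c′ → ∀ i → c′ i ≡ c (fsuc i)) l →
      Any (λ f → Any (λ c′ → ∀ i → c′ i ≡ c i) (map (_∷ᶠ f) (allFin 3))) l
    extend (there p) = there (extend p)
    extend (here {x = f} tail≗) = here (map⁺ (choose (c fzero) refl))
      where
      cons≗ : ∀ α → α ≡ c fzero → ∀ i → (α ∷ᶠ f) i ≡ c i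
      cons≗ α head≡ fzero = head≡
      cons≗ α head≡ (fsuc i) = tail≗ i
      choose : ∀ α → α ≡ c fzero → Any (λ α → ∀ i → (α ∷ᶠ f) i ≡ c i) (allFin 3)
      choose fzero e = here (cons≗ fzero e)
      choose (fsuc fzero) e = there (here (cons≗ (fsuc fzero) e))
      choose (fsuc (fsuc fzero)) e = there (there (here (cons≗ (fsuc (fsuc fzero)) e)))

  rainbowCount≤RM3 : ∀ {n} (c : Coloring n) → rainbowCount c ≤ RM3 n
  rainbowCount≤RM3 {n} c = ≤-max (allColorings-complete n c)
    where
    ≤-max : ∀ {l} → Any (λ c′ → ∀ i → c′ i ≡ c i) l → rainbowCount c ≤ foldr _⊔_ 0 (map rainbowCount l)
    ≤-max (here c′≗c) = ≤-trans (≤-reflexive (rainbowCount-cong (sym ∘ c′≗c))) (m≤m⊔n _ _)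
    ≤-max {c′ ∷ _} (there p) = ≤-trans (≤-max p) (m≤n⊔m (rainbowCount c′) _)

  *-RM3≤ : ∀ m {n B} → (∀ (c : Coloring n) → m * rainbowCount c ≤ B) → m * RM3 n ≤ B
  *-RM3≤ m {n} {B} bound = go (allColorings n)
    where
    go : ∀ l → m * foldr _⊔_ 0 (map rainbowCount l) ≤ B
    go [] = ≤-trans (≤-reflexive (*-zeroʳ m)) z≤n
    go (c ∷ l) = ≤-trans (≤-reflexive (*-distribˡ-⊔ m (rainbowCount c) _)) (⊔-lub (bound c) (go l))

module AMGM where

  open import Data.Nat
  open import Data.Nat.Properties
  open import Data.Nat.Tactic.RingSolver
  open import Data.Sum using (inj₁; inj₂)
  open import Relation.Binary.PropositionalEquality
  open import Algebra.Properties.CommutativeSemigroup *-commutativeSemigroup using (x∙yz≈y∙xz; x∙yz≈x∙zy)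

  AM-GM : ℕ → ℕ → ℕ → Set
  AM-GM a b c = 27 * (a * (b * c)) ≤ (a + b + c) ^ 3

  -- For b = a + u and c = b + v the defect is a polynomial in a, u, v with nonnegative coefficients.
  -- (Identities for the ring solver spell s ^ 3 as its unfolding s * (s * (s * 1)).)
  cube-sorted : ∀ a u v → let s = a + (a + u) + (a + u + v) in
    27 * (a * ((a + u) * (a + u + v))) + (9 * a * (u * u + u * v + v * v) + (2 * u + v) * (2 * u + v) * (2 * u + v))
      ≡ s * (s * (s * 1))
  cube-sorted = solve-∀

  AM-GM-sorted : ∀ {a b c} → a ≤ b → b ≤ c → AM-GM a b c
  AM-GM-sorted {a} {b} {c} a≤b b≤c with b ∸ a | m+[n∸m]≡n a≤b | c ∸ b | m+[n∸m]≡n b≤c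
  ... | u | refl | v | refl = ≤-trans (m≤m+n _ _) (≤-reflexive (cube-sorted a u v))

  AM-GM-swap₁₂ : ∀ a b c → AM-GM a b c → AM-GM b a c
  AM-GM-swap₁₂ a b c = subst₂ (λ p s → 27 * p ≤ s ^ 3) (x∙yz≈y∙xz a b c) (cong (_+ c) (+-comm a b))

  AM-GM-swap₂₃ : ∀ a b c → AM-GM a b c → AM-GM a c b
  AM-GM-swap₂₃ a b c = subst₂ (λ p s → 27 * p ≤ s ^ 3) (x∙yz≈x∙zy a b c)
    (trans (+-assoc a b c) (trans (cong (a +_) (+-comm b c)) (sym (+-assoc a c b))))

  am-gm : ∀ a b c → AM-GM a b c
  am-gm a b c with ≤-total a b | ≤-total b c | ≤-total a c
  ... | inj₁ a≤b | inj₁ b≤c | _        = AM-GM-sorted a≤b b≤c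
  ... | inj₁ a≤b | inj₂ c≤b | inj₁ a≤c = AM-GM-swap₂₃ a c b (AM-GM-sorted a≤c c≤b)
  ... | inj₁ a≤b | inj₂ c≤b | inj₂ c≤a = AM-GM-swap₂₃ a c b (AM-GM-swap₁₂ c a b (AM-GM-sorted c≤a a≤b))
  ... | inj₂ b≤a | inj₁ b≤c | inj₁ a≤c = AM-GM-swap₁₂ b a c (AM-GM-sorted b≤a a≤c)
  ... | inj₂ b≤a | inj₁ b≤c | inj₂ c≤a = AM-GM-swap₁₂ b a c (AM-GM-swap₂₃ b c a (AM-GM-sorted b≤c c≤a))
  ... | inj₂ b≤a | inj₂ c≤b | _        =
    AM-GM-swap₁₂ b a c (AM-GM-swap₂₃ b c a (AM-GM-swap₁₂ c b a (AM-GM-sorted c≤b b≤a)))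

module UpperBound where

  open import Defs
  open import Data.Nat
  open import Data.Nat.Properties
  open import Data.List using (length; allFin)
  open import Data.List.Properties using (length-tabulate)
  open import Data.Fin using (Fin; toℕ; #_)
  open import Data.Fin.Properties using (toℕ-injective)
  open import Data.Product using (_,_)
  open import Function using (_∘_; id)
  open import Relation.Binary.Definitions using (tri<; tri≈; tri>)
  open import Relation.Nullary using (contradiction)
  open import Relation.Binary.PropositionalEquality
  open FiniteSums
  open TripleSums
  open RainbowTriples
  open MaximalCount
  open AMGM

  ascending : ℕ → ℕ → ℕ → ℕ
  ascending p q r = 𝟙 (p <ᵇ q) * 𝟙 (q <ᵇ r)

  𝟙-<ᵇ-yes : ∀ {m n} → m < n → 𝟙 (m <ᵇ n) ≡ 1
  𝟙-<ᵇ-yes m<n = T⇒𝟙≡1 (<⇒<ᵇ m<n)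

  𝟙-<ᵇ-no : ∀ {m n} → n ≤ m → 𝟙 (m <ᵇ n) ≡ 0
  𝟙-<ᵇ-no {m} {n} n≤m = ¬T⇒𝟙≡0 (λ t → <⇒≱ (<ᵇ⇒< m n t) n≤m)

  permSum-ascending≤1 : ∀ {p q r} → p ≢ q → q ≢ r → p ≢ r → permSum ascending p q r ≤ 1
  permSum-ascending≤1 {p} {q} {r} p≢q q≢r p≢r with <-cmp p q | <-cmp q r | <-cmp p r
  ... | tri≈ _ p≡q _ | _ | _ = contradiction p≡q p≢q
  ... | _ | tri≈ _ q≡r _ | _ = contradiction q≡r q≢r
  ... | _ | _ | tri≈ _ p≡r _ = contradiction p≡r p≢r
  ... | tri< p<q _ _ | tri< q<r _ _ | tri> _ _ r<p = contradiction (<-trans p<q q<r) (<-asym r<p)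
  ... | tri> _ _ q<p | tri> _ _ r<q | tri< p<r _ _ = contradiction (<-trans r<q q<p) (<-asym p<r)
  ... | tri< u _ _ | tri< v _ _ | tri< w _ _ rewrite 𝟙-<ᵇ-yes u | 𝟙-<ᵇ-yes v | 𝟙-<ᵇ-yes w
    | 𝟙-<ᵇ-no (<⇒≤ u) | 𝟙-<ᵇ-no (<⇒≤ v) | 𝟙-<ᵇ-no (<⇒≤ w) = ≤-refl
  ... | tri< u _ _ | tri> _ _ v | tri< w _ _ rewrite 𝟙-<ᵇ-yes u | 𝟙-<ᵇ-yes v | 𝟙-<ᵇ-yes w
    | 𝟙-<ᵇ-no (<⇒≤ u) | 𝟙-<ᵇ-no (<⇒≤ v) | 𝟙-<ᵇ-no (<⇒≤ w) = ≤-refl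
  ... | tri< u _ _ | tri> _ _ v | tri> _ _ w rewrite 𝟙-<ᵇ-yes u | 𝟙-<ᵇ-yes v | 𝟙-<ᵇ-yes w
    | 𝟙-<ᵇ-no (<⇒≤ u) | 𝟙-<ᵇ-no (<⇒≤ v) | 𝟙-<ᵇ-no (<⇒≤ w) = ≤-refl
  ... | tri> _ _ u | tri< v _ _ | tri< w _ _ rewrite 𝟙-<ᵇ-yes u | 𝟙-<ᵇ-yes v | 𝟙-<ᵇ-yes w
    | 𝟙-<ᵇ-no (<⇒≤ u) | 𝟙-<ᵇ-no (<⇒≤ v) | 𝟙-<ᵇ-no (<⇒≤ w) = ≤-refl
  ... | tri> _ _ u | tri< v _ _ | tri> _ _ w rewrite 𝟙-<ᵇ-yes u | 𝟙-<ᵇ-yes v | 𝟙-<ᵇ-yes w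
    | 𝟙-<ᵇ-no (<⇒≤ u) | 𝟙-<ᵇ-no (<⇒≤ v) | 𝟙-<ᵇ-no (<⇒≤ w) = ≤-refl
  ... | tri> _ _ u | tri> _ _ v | tri> _ _ w rewrite 𝟙-<ᵇ-yes u | 𝟙-<ᵇ-yes v | 𝟙-<ᵇ-yes w
    | 𝟙-<ᵇ-no (<⇒≤ u) | 𝟙-<ᵇ-no (<⇒≤ v) | 𝟙-<ᵇ-no (<⇒≤ w) = ≤-refl

  m*n≤n : ∀ {m n} → (0 < n → m ≤ 1) → m * n ≤ n
  m*n≤n {m} {zero} _ = ≤-reflexive (*-zeroʳ m)
  m*n≤n {m} {suc n} h = ≤-trans (*-monoˡ-≤ (suc n) (h z<s)) (≤-reflexive (*-identityˡ (suc n)))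

  module _ {n} (c : Coloring n) where

    colorClass : Fin 3 → ℕ
    colorClass k = ∑ (allFin n) (λ x → isColor k (c x))

    colorClasses-partition : colorClass (# 0) + colorClass (# 1) + colorClass (# 2) ≡ n
    colorClasses-partition = begin
      colorClass (# 0) + colorClass (# 1) + colorClass (# 2)
        ≡⟨ cong (_+ colorClass (# 2)) (∑-+ (allFin n) _ _) ⟨
      ∑ (allFin n) (λ x → isColor (# 0) (c x) + isColor (# 1) (c x)) + colorClass (# 2)
        ≡⟨ ∑-+ (allFin n) _ _ ⟨
      ∑ (allFin n) (λ x → isColor (# 0) (c x) + isColor (# 1) (c x) + isColor (# 2) (c x))
        ≡⟨ ∑-cong (allFin n) (isColor-partition ∘ c) ⟩
      ∑ (allFin n) (λ _ → 1)
        ≡⟨ ∑-1≡length (allFin n) ⟩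
      length (allFin n)
        ≡⟨ length-tabulate id ⟩
      n ∎
      where open ≡-Reasoning

    ascendingAt colored : Fin n → Fin n → Fin n → ℕ
    ascendingAt x y z = ascending (toℕ x) (toℕ y) (toℕ z)
    colored x y z = colored012 (c x) (c y) (c z)

    sameColor : ∀ {x y} → toℕ x ≡ toℕ y → c x ≡ c y
    sameColor = cong c ∘ toℕ-injective

    counted≤ascending*permSum : ∀ x y z →
      𝟙 (counted c (x , y , z)) ≤ ascendingAt x y z * permSum colored x y z
    counted≤ascending*permSum x y z = 𝟙-≤ λ t →
      let (x<y , sum≤z , r) = countedTriple-elim {toℕ x} {toℕ y} {toℕ z} {c x} {c y} {c z} sameColor t
          y<z = ≤-trans (m≤n+m (suc (toℕ y)) (suc (toℕ x))) sum≤z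
          ascending-xyz = cong₂ _*_ (𝟙-<ᵇ-yes x<y) (𝟙-<ᵇ-yes y<z)
      in  begin
        1                                           ≤⟨ T⇒1≤𝟙 r ⟩
        𝟙 (rainbow (c x) (c y) (c z))               ≤⟨ rainbow≤permSum-colored012 (c x) (c y) (c z) ⟩
        permSum colored x y z                       ≡⟨ *-identityˡ _ ⟨
        1 * permSum colored x y z                   ≡⟨ cong (_* permSum colored x y z) ascending-xyz ⟨
        ascendingAt x y z * permSum colored x y z   ∎
      where open ≤-Reasoning

    permSum-ascending*colored≤colored : ∀ x y z → permSum ascendingAt x y z * colored x y z ≤ colored x y z
    permSum-ascending*colored≤colored x y z = m*n≤n λ 0<colored →
      let rainbow-xyz = 1≤𝟙⇒T (≤-trans 0<colored (colored012≤rainbow (c x) (c y) (c z)))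
          (cx≢cy , cy≢cz , cx≢cz) = rainbow⇒≢ rainbow-xyz
      in  permSum-ascending≤1 (cx≢cy ∘ sameColor) (cy≢cz ∘ sameColor) (cx≢cz ∘ sameColor)

    rainbowCount≤colorClasses : rainbowCount c ≤ colorClass (# 0) * (colorClass (# 1) * colorClass (# 2))
    rainbowCount≤colorClasses = begin
      rainbowCount c
        ≡⟨ rainbowCount≡∑³ c ⟩
      ∑³ (allFin n) (λ x y z → 𝟙 (counted c (x , y , z)))
        ≤⟨ ∑³-mono (allFin n) counted≤ascending*permSum ⟩
      ∑³ (allFin n) (λ x y z → ascendingAt x y z * permSum colored x y z)
        ≡⟨ ∑³-permSum-adjoint (allFin n) ascendingAt colored ⟩
      ∑³ (allFin n) (λ x y z → permSum ascendingAt x y z * colored x y z)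
        ≤⟨ ∑³-mono (allFin n) permSum-ascending*colored≤colored ⟩
      ∑³ (allFin n) colored
        ≡⟨ ∑³-product (allFin n) (isColor (# 0) ∘ c) (isColor (# 1) ∘ c) (isColor (# 2) ∘ c) ⟩
      colorClass (# 0) * (colorClass (# 1) * colorClass (# 2))
        ∎
      where open ≤-Reasoning

    27*rainbowCount≤n³ : 27 * rainbowCount c ≤ n ^ 3
    27*rainbowCount≤n³ = begin
      27 * rainbowCount c
        ≤⟨ *-monoʳ-≤ 27 rainbowCount≤colorClasses ⟩
      27 * (colorClass (# 0) * (colorClass (# 1) * colorClass (# 2)))
        ≤⟨ am-gm (colorClass (# 0)) (colorClass (# 1)) (colorClass (# 2)) ⟩
      (colorClass (# 0) + colorClass (# 1) + colorClass (# 2)) ^ 3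
        ≡⟨ cong (_^ 3) colorClasses-partition ⟩
      n ^ 3
        ∎
      where open ≤-Reasoning

  27*RM3≤n³ : ∀ n → 27 * RM3 n ≤ n ^ 3
  27*RM3≤n³ n = *-RM3≤ 27 {n} {n ^ 3} 27*rainbowCount≤n³

module LowerBound where

  open import Defs
  open import Data.Nat
  open import Data.Nat.Properties
  open import Data.Nat.DivMod
  open import Data.Nat.Divisibility using (divides)
  open import Data.Bool using (T; if_then_else_)
  open import Data.List using (allFin)
  open import Data.Fin using (Fin; toℕ; #_)
  open import Data.Product using (_,_)
  open import Function using (_∘_)
  open import Relation.Binary.PropositionalEquality
  open FiniteSums
  open RainbowTriples
  open MaximalCount

  rainbowSum : (ℕ → Fin 3) → ℕ → ℕ
  rainbowSum κ m = ∑< m λ a → ∑< m λ b → ∑< m λ d → 𝟙 (countedTriple a b d (κ a) (κ b) (κ d))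

  rainbowCount≡rainbowSum : ∀ κ n → rainbowCount {n} (κ ∘ toℕ) ≡ rainbowSum κ n
  rainbowCount≡rainbowSum κ n = trans (rainbowCount≡∑³ {n} (κ ∘ toℕ))
    (trans (∑-cong (allFin n) λ x → trans (∑-cong (allFin n) λ y → ∑-allFin n _) (∑-allFin n _)) (∑-allFin n _))

  rainbowSum-mono : ∀ κ {m n} → m ≤ n → rainbowSum κ m ≤ rainbowSum κ n
  rainbowSum-mono κ {m} m≤n =
    ≤-trans (∑<-mono m λ a _ → ≤-trans (∑<-mono m λ b _ → ∑<-monoˡ _ m≤n) (∑<-monoˡ _ m≤n)) (∑<-monoˡ _ m≤n)

  blowUp : (p : ℕ) .{{_ : NonZero p}} → (ℕ → Fin 3) → ℕ → Fin 3
  blowUp p κ i = κ (i / p)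

  module _ {p : ℕ} .{{_ : NonZero p}} where

    [X*p+j]/p≡X : ∀ X {j} → j < p → (X * p + j) / p ≡ X
    [X*p+j]/p≡X X {j} j<p = begin
      (X * p + j) / p      ≡⟨ +-distrib-/-∣ˡ j (divides X refl) ⟩
      X * p / p + j / p    ≡⟨ cong₂ _+_ (m*n/n≡m X p) (m<n⇒m/n≡0 j<p) ⟩
      X + 0                ≡⟨ +-identityʳ X ⟩
      X                    ∎
      where open ≡-Reasoning

    in-block : ∀ X {j} → j < p → suc (X * p + j) ≤ suc X * p
    in-block X {j} j<p = begin
      suc (X * p + j)   ≡⟨ +-suc (X * p) j ⟨
      X * p + suc j     ≤⟨ +-monoʳ-≤ (X * p) j<p ⟩
      X * p + p         ≡⟨ +-comm (X * p) p ⟩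
      suc X * p         ∎
      where open ≤-Reasoning

    countedTriple-blowUp : ∀ κ X Y Z {j k l} → j < p → k < p → l < p →
      T (countedTriple X Y Z (κ X) (κ Y) (κ Z)) →
      T (countedTriple (X * p + j) (Y * p + k) (Z * p + l)
           (blowUp p κ (X * p + j)) (blowUp p κ (Y * p + k)) (blowUp p κ (Z * p + l)))
    countedTriple-blowUp κ X Y Z {j} {k} {l} j<p k<p l<p t
      rewrite [X*p+j]/p≡X X j<p | [X*p+j]/p≡X Y k<p | [X*p+j]/p≡X Z l<p
      with X<Y , sum≤Z , r ← countedTriple-elim {X} {Y} {Z} {κ X} {κ Y} {κ Z} (cong κ) t =
      countedTriple-intro {α = κ X} {κ Y} {κ Z}
        (<⇒≤ (≤-trans (in-block X j<p) (≤-trans (*-monoˡ-≤ p X<Y) (m≤m+n (Y * p) k))))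
        (begin
          suc (X * p + j) + suc (Y * p + k)   ≤⟨ +-mono-≤ (in-block X j<p) (in-block Y k<p) ⟩
          suc X * p + suc Y * p               ≡⟨ *-distribʳ-+ p (suc X) (suc Y) ⟨
          (suc X + suc Y) * p                 ≤⟨ *-monoˡ-≤ p sum≤Z ⟩
          Z * p                               ≤⟨ m≤m+n (Z * p) l ⟩
          Z * p + l                           ∎)
        r
      where open ≤-Reasoning

  rainbowSum-blowUp : ∀ κ t p .{{_ : NonZero p}} →
    p * (p * (p * rainbowSum κ t)) ≤ rainbowSum (blowUp p κ) (t * p)
  rainbowSum-blowUp κ t p = begin
    p * (p * (p * ∑< t (λ X → ∑< t λ Y → triples X Y)))
      ≡⟨ cong (p *_) (cong (p *_) (∑<-*ˡ t p _)) ⟨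
    p * (p * ∑< t (λ X → p * ∑< t λ Y → triples X Y))
      ≡⟨ cong (p *_) (∑<-*ˡ t p _) ⟨
    p * ∑< t (λ X → p * (p * ∑< t λ Y → triples X Y))
      ≡⟨ cong (p *_) (∑<-cong t λ X → cong (p *_) (∑<-*ˡ t p _)) ⟨
    p * ∑< t (λ X → p * ∑< t λ Y → p * triples X Y)
      ≤⟨ ∑<-blowUp t p (λ X j j<p → ∑<-blowUp t p (λ Y k k<p → ∑<-blowUp t p (λ Z l l<p →
           𝟙-mono (countedTriple-blowUp κ X Y Z j<p k<p l<p)))) ⟩
    rainbowSum (blowUp p κ) (t * p) ∎
    where
    open ≤-Reasoning
    triples : ℕ → ℕ → ℕ
    triples X Y = ∑< t λ Z → 𝟙 (countedTriple X Y Z (κ X) (κ Y) (κ Z))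

  threeIntervals : ℕ → Fin 3
  threeIntervals i = if i <ᵇ 24 then # 0 else if i <ᵇ 57 then # 1 else # 2

  rainbowSum-threeIntervals : rainbowSum threeIntervals 90 ≡ 23536
  rainbowSum-threeIntervals = refl

  RM3-lower : ∀ p n → 90 * p ≤ n → p * (p * (p * 23536)) ≤ RM3 n
  RM3-lower zero n _ = z≤n
  RM3-lower (suc q) n = blownUp-lower (suc q) n
    where
    blownUp-lower : ∀ p .{{_ : NonZero p}} n → 90 * p ≤ n → p * (p * (p * 23536)) ≤ RM3 n
    blownUp-lower p n 90p≤n = begin
      p * (p * (p * 23536))                           ≡⟨ cong (λ s → p * (p * (p * s))) rainbowSum-threeIntervals ⟨
      p * (p * (p * rainbowSum threeIntervals 90))    ≤⟨ rainbowSum-blowUp threeIntervals 90 p ⟩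
      rainbowSum (blowUp p threeIntervals) (90 * p)   ≤⟨ rainbowSum-mono (blowUp p threeIntervals) 90p≤n ⟩
      rainbowSum (blowUp p threeIntervals) n          ≡⟨ rainbowCount≡rainbowSum (blowUp p threeIntervals) n ⟨
      rainbowCount {n} (blowUp p threeIntervals ∘ toℕ) ≤⟨ rainbowCount≤RM3 {n} (blowUp p threeIntervals ∘ toℕ) ⟩
      RM3 n                                           ∎
      where open ≤-Reasoning

module CubeBounds where

  open import Defs using (RM3)
  open import Data.Nat
  open import Data.Nat.Properties
  open import Data.Nat.DivMod
  open import Data.Nat.Tactic.RingSolver
  open import Relation.Binary.PropositionalEquality
  open LowerBound using (RM3-lower)

  cube-expansion : ∀ M r → let n = M + r in
    n * (n * (n * 1)) + (3 * M * r * r + 2 * r * r * r) ≡ M * (M * (M * 1)) + 3 * r * (n * (n * 1))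
  cube-expansion = solve-∀

  cube-perturbation : ∀ {K M r R} n → n ≡ M + r → K * r < n → M ^ 3 ≤ 31 * R →
    K * n ^ 3 < 31 * K * R + 31 * n ^ 3
  cube-perturbation {K} {M} {r} {R} n refl Kr<n M³≤31R = begin-strict
    K * n ^ 3                             ≤⟨ *-monoʳ-≤ K (≤-trans (m≤m+n (n ^ 3) _) (≤-reflexive (cube-expansion M r))) ⟩
    K * (M ^ 3 + 3 * r * n ^ 2)           ≡⟨ rearrange K M r (n ^ 2) ⟩
    K * M ^ 3 + 3 * (K * r) * n ^ 2       ≤⟨ +-monoˡ-≤ _ (*-monoʳ-≤ K M³≤31R) ⟩
    K * (31 * R) + 3 * (K * r) * n ^ 2    <⟨ +-monoʳ-< _ (*-monoˡ-< (n ^ 2) {{m^n≢0 n 2 {{>-nonZero 0<n}}}} 3Kr<31n) ⟩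
    K * (31 * R) + 31 * n * n ^ 2         ≡⟨ collect K R n ⟩
    31 * K * R + 31 * n ^ 3               ∎
    where
    open ≤-Reasoning
    0<n : 0 < n
    0<n = ≤-<-trans z≤n Kr<n
    3Kr<31n : 3 * (K * r) < 31 * n
    3Kr<31n = <-≤-trans (*-monoʳ-< 3 Kr<n) (*-monoˡ-≤ n (m≤m+n 3 28))
    rearrange : ∀ a b c d → a * (b * (b * (b * 1)) + 3 * c * d) ≡ a * (b * (b * (b * 1))) + 3 * (a * c) * d
    rearrange = solve-∀
    collect : ∀ a b c → a * (31 * b) + 31 * c * (c * (c * 1)) ≡ 31 * a * b + 31 * (c * (c * (c * 1)))
    collect = solve-∀

  -- 31 · 23536 = 729616 ≥ 729000 = 90³
  cube-of-blocks : ∀ q → (q * 90) * ((q * 90) * ((q * 90) * 1)) + 616 * (q * (q * q)) ≡ 31 * (q * (q * (q * 23536)))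
  cube-of-blocks = solve-∀

  RM3-lower-asymptotic : ∀ K .{{_ : NonZero K}} n → 90 * K ≤ n → K * n ^ 3 < 31 * K * RM3 n + 31 * n ^ 3
  RM3-lower-asymptotic K n 90K≤n = cube-perturbation {K} {q * 90} {r} {RM3 n} n n≡M+r Kr<n M³≤31R
    where
    q = n / 90
    r = n % 90
    n≡M+r : n ≡ q * 90 + r
    n≡M+r = trans (m≡m%n+[m/n]*n n 90) (+-comm r (q * 90))
    Kr<n : K * r < n
    Kr<n = <-≤-trans (*-monoʳ-< K (m%n<n n 90)) (≤-trans (≤-reflexive (*-comm K 90)) 90K≤n)
    90q≤n : 90 * q ≤ n
    90q≤n = ≤-trans (≤-reflexive (*-comm 90 q)) (≤-trans (m≤m+n (q * 90) r) (≤-reflexive (sym n≡M+r)))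
    M³≤31R : (q * 90) ^ 3 ≤ 31 * RM3 n
    M³≤31R = begin
      (q * 90) ^ 3                          ≤⟨ m≤m+n _ _ ⟩
      (q * 90) ^ 3 + 616 * (q * (q * q))    ≡⟨ cube-of-blocks q ⟩
      31 * (q * (q * (q * 23536)))          ≤⟨ *-monoʳ-≤ 31 (RM3-lower q n 90q≤n) ⟩
      31 * RM3 n                            ∎
      where open ≤-Reasoning

module RationalBounds where

  open import Data.Nat as ℕ using (suc)
  import Data.Nat.Properties as ℕ
  open import Data.Nat.Tactic.RingSolver as ℕ-Solver using ()
  open import Data.Integer as ℤ using (+_; +≤+; +<+)
  import Data.Integer.Properties as ℤ
  open import Data.Integer.Tactic.RingSolver as ℤ-Solver using ()
  open import Data.Rational using (_/_; _+_; _-_; -_; _*_; _≤_; _<_; toℚᵘ)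
  open import Data.Rational.Properties
    using (toℚᵘ-fromℚᵘ; toℚᵘ-cancel-≤; toℚᵘ-cancel-<; toℚᵘ-homo-+; toℚᵘ-homo-*; toℚᵘ-homo‿-)
  open import Data.Rational.Unnormalised as ℚᵘ using (mkℚᵘ; *≤*; *<*)
  import Data.Rational.Unnormalised.Properties as ℚᵘ
  open import Relation.Binary.PropositionalEquality

  toℚᵘ-/ : ∀ n d → toℚᵘ (+ n / suc d) ℚᵘ.≃ mkℚᵘ (+ n) d
  toℚᵘ-/ n d = toℚᵘ-fromℚᵘ (mkℚᵘ (+ n) d)

  -- upper-ℤ and lower-ℤ are stated in exactly the cross-multiplied shape that *≤* and *<*
  -- demand for the unnormalised fractions in upper-ℚ and lower-ℚ.
  upper-ℤ : ∀ K R N → 27 ℕ.* R ℕ.≤ N →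
    + R ℤ.* + (27 ℕ.* K ℕ.* 1) ℤ.≤ ((+ 1 ℤ.* + K ℤ.+ + 1 ℤ.* + 27) ℤ.* + N) ℤ.* + 1
  upper-ℤ K R N 27R≤N = begin
    + R ℤ.* + (27 ℕ.* K ℕ.* 1)                        ≡⟨ ℤ.pos-* R _ ⟨
    + (R ℕ.* (27 ℕ.* K ℕ.* 1))                        ≡⟨ cong +_ (ℕ-identity R K) ⟩
    + (27 ℕ.* R ℕ.* K)                                ≤⟨ +≤+ (ℕ.≤-trans (ℕ.*-monoˡ-≤ K 27R≤N) (ℕ.m≤m+n _ _)) ⟩
    + (N ℕ.* K ℕ.+ 27 ℕ.* N)                          ≡⟨ ℤ.pos-+ (N ℕ.* K) (27 ℕ.* N) ⟩
    + (N ℕ.* K) ℤ.+ + (27 ℕ.* N)                      ≡⟨ cong₂ ℤ._+_ (ℤ.pos-* N K) (ℤ.pos-* 27 N) ⟩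
    + N ℤ.* + K ℤ.+ + 27 ℤ.* + N                      ≡⟨ ℤ-identity (+ K) (+ N) ⟩
    ((+ 1 ℤ.* + K ℤ.+ + 1 ℤ.* + 27) ℤ.* + N) ℤ.* + 1  ∎
    where
    open ℤ.≤-Reasoning
    ℕ-identity : ∀ R K → R ℕ.* (27 ℕ.* K ℕ.* 1) ≡ 27 ℕ.* R ℕ.* K
    ℕ-identity = ℕ-Solver.solve-∀
    ℤ-identity : ∀ K N → N ℤ.* K ℤ.+ + 27 ℤ.* N ≡ ((+ 1 ℤ.* K ℤ.+ + 1 ℤ.* + 27) ℤ.* N) ℤ.* + 1
    ℤ-identity = ℤ-Solver.solve-∀

  lower-ℤ : ∀ K R N → K ℕ.* N ℕ.< 31 ℕ.* K ℕ.* R ℕ.+ 31 ℕ.* N →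
    ((+ 1 ℤ.* + K ℤ.+ (ℤ.- + 1) ℤ.* + 31) ℤ.* + N) ℤ.* + 1 ℤ.< + R ℤ.* + (31 ℕ.* K ℕ.* 1)
  lower-ℤ K R N KN<31KR+31N = begin-strict
    ((+ 1 ℤ.* + K ℤ.+ (ℤ.- + 1) ℤ.* + 31) ℤ.* + N) ℤ.* + 1   ≡⟨ ℤ-identity₁ (+ K) (+ N) ⟩
    + K ℤ.* + N ℤ.- + 31 ℤ.* + N                             ≡⟨ cong₂ ℤ._-_ (ℤ.pos-* K N) (ℤ.pos-* 31 N) ⟨
    + (K ℕ.* N) ℤ.- + (31 ℕ.* N)                             <⟨ ℤ.+-monoˡ-< (ℤ.- + (31 ℕ.* N)) (+<+ KN<31KR+31N) ⟩
    + (31 ℕ.* K ℕ.* R ℕ.+ 31 ℕ.* N) ℤ.- + (31 ℕ.* N)         ≡⟨ cong (ℤ._- + (31 ℕ.* N)) (ℤ.pos-+ (31 ℕ.* K ℕ.* R) _) ⟩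
    + (31 ℕ.* K ℕ.* R) ℤ.+ + (31 ℕ.* N) ℤ.- + (31 ℕ.* N)     ≡⟨ ℤ-identity₂ (+ (31 ℕ.* K ℕ.* R)) (+ (31 ℕ.* N)) ⟩
    + (31 ℕ.* K ℕ.* R)                                       ≡⟨ cong +_ (ℕ-identity R K) ⟩
    + (R ℕ.* (31 ℕ.* K ℕ.* 1))                               ≡⟨ ℤ.pos-* R _ ⟩
    + R ℤ.* + (31 ℕ.* K ℕ.* 1)                               ∎
    where
    open ℤ.≤-Reasoning
    ℕ-identity : ∀ R K → 31 ℕ.* K ℕ.* R ≡ R ℕ.* (31 ℕ.* K ℕ.* 1)
    ℕ-identity = ℕ-Solver.solve-∀
    ℤ-identity₁ : ∀ K N → ((+ 1 ℤ.* K ℤ.+ (ℤ.- + 1) ℤ.* + 31) ℤ.* N) ℤ.* + 1 ≡ K ℤ.* N ℤ.- + 31 ℤ.* N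
    ℤ-identity₁ = ℤ-Solver.solve-∀
    ℤ-identity₂ : ∀ a b → a ℤ.+ b ℤ.- b ≡ a
    ℤ-identity₂ = ℤ-Solver.solve-∀

  upper-ℚ : ∀ k R N → 27 ℕ.* R ℕ.≤ N → (+ R / 1) ≤ ((+ 1 / 27) + (+ 1 / suc k)) * (+ N / 1)
  upper-ℚ k R N 27R≤N = toℚᵘ-cancel-≤ (begin
    toℚᵘ (+ R / 1)                                           ≃⟨ toℚᵘ-/ R 0 ⟩
    mkℚᵘ (+ R) 0                                             ≤⟨ *≤* (upper-ℤ (suc k) R N 27R≤N) ⟩
    (mkℚᵘ (+ 1) 26 ℚᵘ.+ mkℚᵘ (+ 1) k) ℚᵘ.* mkℚᵘ (+ N) 0      ≃⟨ homomorphism ⟨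
    toℚᵘ (((+ 1 / 27) + (+ 1 / suc k)) * (+ N / 1))          ∎)
    where
    open ℚᵘ.≤-Reasoning
    homomorphism : toℚᵘ (((+ 1 / 27) + (+ 1 / suc k)) * (+ N / 1))
                     ℚᵘ.≃ (mkℚᵘ (+ 1) 26 ℚᵘ.+ mkℚᵘ (+ 1) k) ℚᵘ.* mkℚᵘ (+ N) 0
    homomorphism = ℚᵘ.≃-trans (toℚᵘ-homo-* ((+ 1 / 27) + (+ 1 / suc k)) (+ N / 1)) (ℚᵘ.*-cong
      (ℚᵘ.≃-trans (toℚᵘ-homo-+ (+ 1 / 27) (+ 1 / suc k)) (ℚᵘ.+-cong (toℚᵘ-/ 1 26) (toℚᵘ-/ 1 k)))
      (toℚᵘ-/ N 0))

  lower-ℚ : ∀ k R N → suc k ℕ.* N ℕ.< 31 ℕ.* suc k ℕ.* R ℕ.+ 31 ℕ.* N →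
    ((+ 1 / 31) - (+ 1 / suc k)) * (+ N / 1) < (+ R / 1)
  lower-ℚ k R N h = toℚᵘ-cancel-< (begin-strict
    toℚᵘ (((+ 1 / 31) - (+ 1 / suc k)) * (+ N / 1))          ≃⟨ homomorphism ⟩
    (mkℚᵘ (+ 1) 30 ℚᵘ.- mkℚᵘ (+ 1) k) ℚᵘ.* mkℚᵘ (+ N) 0      <⟨ *<* (lower-ℤ (suc k) R N h) ⟩
    mkℚᵘ (+ R) 0                                             ≃⟨ toℚᵘ-/ R 0 ⟨
    toℚᵘ (+ R / 1)                                           ∎)
    where
    open ℚᵘ.≤-Reasoning
    homomorphism : toℚᵘ (((+ 1 / 31) - (+ 1 / suc k)) * (+ N / 1))
                     ℚᵘ.≃ (mkℚᵘ (+ 1) 30 ℚᵘ.- mkℚᵘ (+ 1) k) ℚᵘ.* mkℚᵘ (+ N) 0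
    homomorphism = ℚᵘ.≃-trans (toℚᵘ-homo-* ((+ 1 / 31) - (+ 1 / suc k)) (+ N / 1)) (ℚᵘ.*-cong
      (ℚᵘ.≃-trans (toℚᵘ-homo-+ (+ 1 / 31) (- (+ 1 / suc k))) (ℚᵘ.+-cong (toℚᵘ-/ 1 30)
        (ℚᵘ.≃-trans (toℚᵘ-homo‿- (+ 1 / suc k)) (ℚᵘ.-‿cong (toℚᵘ-/ 1 k)))))
      (toℚᵘ-/ N 0))

open import Defs
open import Data.Nat using (ℕ; suc; _≥_; _^_)
open import Data.Integer using (+_)
open import Data.Rational using (_/_; _+_; _-_; _*_; _<_; _≤_)
open import Data.Product using (Σ; _×_; _,_)
import Data.Nat as ℕ
open UpperBound using (27*RM3≤n³)
open CubeBounds using (RM3-lower-asymptotic)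
open RationalBounds using (upper-ℚ; lower-ℚ)

theorem5p6 : (k : ℕ) → Σ ℕ (λ N → (n : ℕ) → n ≥ N →
    (((+ 1 / 31) - (+ 1 / suc k)) * (+ (n ^ 3) / 1) < (+ (RM3 n) / 1))
    × ((+ (RM3 n) / 1) ≤ ((+ 1 / 27) + (+ 1 / suc k)) * (+ (n ^ 3) / 1)))
theorem5p6 k = 90 ℕ.* suc k , λ n n≥90K →
  lower-ℚ k (RM3 n) (n ^ 3) (RM3-lower-asymptotic (suc k) n n≥90K) , upper-ℚ k (RM3 n) (n ^ 3) (27*RM3≤n³ n)
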